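{- Let $H_3$ be the $3$-uniform hypergraph with vertex set $\{1,2,3,4,5\}$ whose edges are all $3$-element subsets except $\{1,2,3\}$ and $\{1,4,5\}$. Then $H_3$ has at least $t(5,4,3)+1$ edges, $H_3$ does not contain two distinct copies of $K^3_4$, and $H_3$ does not contain a copy of $K_5^{3- }$. In particular, the answer to each of the following questions is negative: "Does every $3$-uniform hypergraph with $t(n,s,3)+1$ edges contain two copies of $K^3_s$?" and "Does every $3$-uniform hypergraph with $t(n,s,3)+1$ edges contain $K_{s+1}^{3- }$?"
   Context: $K^3_s$ is the complete $3$-uniform hypergraph on $s$ vertices, and $K_{s+1}^{3- }$ is the $3$-uniform hypergraph on $s+1$ vertices obtained from $K^3_{s+1}$ by removing one edge. Containment means containment as a (not necessarily induced) subhypergraph. The Turán number $t(n,s,3)$ is the maximum number of edges in a $3$-uniform hypergraph on $n$ vertices containing no copy of $K^3_s$. -}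

module Defs where

open import Data.Nat using (ℕ; zero; suc; _+_; _≤_)
open import Data.Bool using (Bool; true; false; T; not; _∧_; if_then_else_)
open import Data.Vec using (Vec; []; _∷_)
open import Data.List using (List; []; _∷_; _++_; map; length; filterᵇ)
open import Data.Fin using (Fin)
open import Data.Fin.Subset using (Subset; ∣_∣; _⊆_)
open import Data.Product using (Σ; _×_; ∃; ∃-syntax)
open import Relation.Binary.PropositionalEquality using (_≡_; _≢_)
open import Relation.Nullary using (¬_; does)
import Data.Nat as ℕ
import Data.Nat.Properties as NP
import Data.Bool.Properties as BP
import Relation.Nullary.Decidable
import Data.Product
import Function.Bundles
import Data.Vec.Properties as VP
import Data.Bool as B

record Hypergraph3 (n : ℕ) : Set where
  field
    edge    : Subset n → Bool
    uniform : ∀ e → T (edge e) → ∣ e ∣ ≡ 3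
open Hypergraph3 public

allSubsets : (n : ℕ) → List (Subset n)
allSubsets zero    = [] ∷ []
allSubsets (suc n) = map (true ∷_) (allSubsets n) ++ map (false ∷_) (allSubsets n)

numEdges : ∀ {n} → Hypergraph3 n → ℕ
numEdges {n} H = length (filterᵇ (edge H) (allSubsets n))

IsK : ∀ {n} → Hypergraph3 n → ℕ → Subset n → Set
IsK {n} H s S = ∣ S ∣ ≡ s × (∀ (e : Subset n) → ∣ e ∣ ≡ 3 → e ⊆ S → T (edge H e))

ContainsK : ∀ {n} → ℕ → Hypergraph3 n → Set
ContainsK s H = ∃[ S ] IsK H s S

ContainsTwoK : ∀ {n} → ℕ → Hypergraph3 n → Set
ContainsTwoK s H = ∃[ S₁ ] ∃[ S₂ ] (S₁ ≢ S₂ × IsK H s S₁ × IsK H s S₂)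

-- H contains a copy of K^{3-}_{s+1}: a vertex set S of size s+1 and a triple
-- D ⊆ S such that every 3-subset of S other than D is an edge.
ContainsKminus : ∀ {n} → ℕ → Hypergraph3 n → Set
ContainsKminus {n} s H =
  ∃[ S ] ∃[ D ] (∣ S ∣ ≡ suc s × ∣ D ∣ ≡ 3 × D ⊆ S ×
    (∀ (e : Subset n) → ∣ e ∣ ≡ 3 → e ⊆ S → e ≢ D → T (edge H e)))

IsTuranNumber : ℕ → ℕ → ℕ → Set
IsTuranNumber n s t =
  (∃[ H ] (¬ ContainsK s H × numEdges {n} H ≡ t)) ×
  (∀ (H : Hypergraph3 n) → ¬ ContainsK s H → numEdges H ≤ t)

-- H₃ on {1,…,5} = Fin 5 (vertex i ↦ index i-1)
e123 : Subset 5
e123 = true ∷ true ∷ true ∷ false ∷ false ∷ []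

e145 : Subset 5
e145 = true ∷ false ∷ false ∷ true ∷ true ∷ []

H₃-edge : Subset 5 → Bool
H₃-edge e = (∣ e ∣ ℕ.≡ᵇ 3) ∧ not (does (VP.≡-dec B._≟_ e e123))
                              ∧ not (does (VP.≡-dec B._≟_ e e145))

private
  H₃-uniform : ∀ e → T (H₃-edge e) → ∣ e ∣ ≡ 3
  H₃-uniform e p =
    NP.≡ᵇ⇒≡ ∣ e ∣ 3
      (Data.Product.proj₁ (Function.Bundles.Equivalence.to (BP.T-∧ {∣ e ∣ ℕ.≡ᵇ 3}) p))

H₃ : Hypergraph3 5
H₃ = record { edge = H₃-edge ; uniform = H₃-uniform }

module Submission where

--  * A clique cannot contain a non-edge; a K⁻ cannot contain two distinct
--    non-edges.  These give the structural facts about H₃: its only K⁴ is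
--    {2,3,4,5}, and the unique 5-set contains the two non-edges.
--  * Turán number t(5,4,3) = 7.  Deleting the edge {2,3,4} from H₃ leaves a
--    K⁴-free hypergraph with 7 edges.  Conversely, encode the edge set of a
--    hypergraph on Fin 5 as a subset of the ten triples; each 4-set spans a
--    block of four triples, and K⁴-freeness says no block is full.  A
--    check over all 2¹⁰ subsets of the triples shows that such a set has at
--    most 7 elements (each triple lies in two of the five blocks, so at least
--    three triples are missing).
--  * Since H₃ has 8 = t(5,4,3) + 1 edges, it refutes both questions.

open import Defs
open import Data.Nat using (ℕ; suc; _≤_; _≤?_; _≟_; _≡ᵇ_; s≤s)
open import Data.Nat.Properties using (≡⇒≡ᵇ)
open import Data.Bool using (Bool; true; false; T; not; _∧_)
open import Data.Bool.Properties using (T-∧; T-≡)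
import Data.Bool as Bool
open import Data.Vec using (Vec; []; _∷_; lookup; map; toList)
open import Data.Vec.Properties using (≡-dec; lookup-map; []=⇒lookup; lookup⇒[]=)
open import Data.List using (length; filterᵇ)
import Data.List as List
open import Data.Fin.Subset using (Subset; ∣_∣; _⊆_; _∈_)
open import Data.Fin.Subset.Properties using (_⊆?_; anySubset?; ∣p∣≡n⇒p≡⊤; ⊆⊤)
open import Data.Fin.Properties using (all?; any?)
open import Data.Product using (_×_; ∃; _,_; proj₁)
open import Data.Sum using (_⊎_; inj₁; inj₂)
open import Data.Empty using (⊥-elim)
open import Function.Bundles using (Equivalence)
open import Relation.Binary.PropositionalEquality
  using (_≡_; _≢_; refl; sym; trans; subst; cong; module ≡-Reasoning)
open import Relation.Nullary using (Dec; yes; no; ¬_; ¬?; does)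
open import Relation.Nullary.Decidable
  using (map′; decidable-stable; from-yes; dec-true; _→-dec_; _⊎-dec_)
open import Relation.Unary using (Pred; Decidable)

-- A decidable property of subsets holds for all of them iff no subset
-- violates it; this makes finite statements about Subset n checkable by
-- evaluation via `from-yes`.
allSubsets? : ∀ {n ℓ} {P : Pred (Subset n) ℓ} → Decidable P → Dec (∀ S → P S)
allSubsets? P? =
  map′ (λ noCounterexample S → decidable-stable (P? S) (λ ¬p → noCounterexample (S , ¬p)))
       (λ all (S , ¬p) → ¬p (all S))
       (¬? (anySubset? (λ S → ¬? (P? S))))

filterᵇ-absorb : ∀ {A : Set} {p q : A → Bool} → (∀ x → T (p x) → T (q x)) →
                 ∀ xs → filterᵇ p (filterᵇ q xs) ≡ filterᵇ p xs
filterᵇ-absorb p⇒q List.[] = refl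
filterᵇ-absorb {p = p} {q} p⇒q (x List.∷ xs) with q x in qx
... | true with p x
...   | true  = cong (x List.∷_) (filterᵇ-absorb p⇒q xs)
...   | false = filterᵇ-absorb p⇒q xs
filterᵇ-absorb {p = p} {q} p⇒q (x List.∷ xs) | false with p x in px
...   | true  = ⊥-elim (subst T qx (p⇒q x (subst T (sym px) _)))
...   | false = filterᵇ-absorb p⇒q xs

length-filterᵇ : ∀ {A : Set} {m} (p : A → Bool) (v : Vec A m) →
                 length (filterᵇ p (toList v)) ≡ ∣ map p v ∣
length-filterᵇ p [] = refl
length-filterᵇ p (x ∷ v) with p x
... | true  = cong suc (length-filterᵇ p v)
... | false = length-filterᵇ p v

deleteEdge : ∀ {n} → Hypergraph3 n → Subset n → Hypergraph3 n
deleteEdge H e = record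
  { edge    = λ f → edge H f ∧ not (does (≡-dec Bool._≟_ f e))
  ; uniform = λ f p → uniform H f (proj₁ (Equivalence.to T-∧ p)) }

nonEdge⇒¬IsK : ∀ {n} (H : Hypergraph3 n) {s} {S e : Subset n} →
               ∣ e ∣ ≡ 3 → e ⊆ S → ¬ T (edge H e) → ¬ IsK H s S
nonEdge⇒¬IsK H ∣e∣≡3 e⊆S ¬e (_ , clique) = ¬e (clique _ ∣e∣≡3 e⊆S)

twoNonEdges⇒¬Kminus : ∀ {n} (H : Hypergraph3 n) {S D e f : Subset n} →
  ∣ e ∣ ≡ 3 → ∣ f ∣ ≡ 3 → e ⊆ S → f ⊆ S → e ≢ f →
  ¬ T (edge H e) → ¬ T (edge H f) →
  ¬ (∀ (g : Subset n) → ∣ g ∣ ≡ 3 → g ⊆ S → g ≢ D → T (edge H g))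
twoNonEdges⇒¬Kminus H {D = D} {e} {f} ∣e∣≡3 ∣f∣≡3 e⊆S f⊆S e≢f ¬e ¬f almostClique
  with ≡-dec Bool._≟_ e D
... | yes refl = ¬f (almostClique f ∣f∣≡3 f⊆S (λ f≡e → e≢f (sym f≡e)))
... | no  e≢D  = ¬e (almostClique e ∣e∣≡3 e⊆S e≢D)

-- The ten triples of Fin 5, in the order in which `allSubsets 5` lists them.
triples : Vec (Subset 5) 10
triples =
  (true  ∷ true  ∷ true  ∷ false ∷ false ∷ []) ∷
  (true  ∷ true  ∷ false ∷ true  ∷ false ∷ []) ∷
  (true  ∷ true  ∷ false ∷ false ∷ true  ∷ []) ∷
  (true  ∷ false ∷ true  ∷ true  ∷ false ∷ []) ∷
  (true  ∷ false ∷ true  ∷ false ∷ true  ∷ []) ∷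
  (true  ∷ false ∷ false ∷ true  ∷ true  ∷ []) ∷
  (false ∷ true  ∷ true  ∷ true  ∷ false ∷ []) ∷
  (false ∷ true  ∷ true  ∷ false ∷ true  ∷ []) ∷
  (false ∷ true  ∷ false ∷ true  ∷ true  ∷ []) ∷
  (false ∷ false ∷ true  ∷ true  ∷ true  ∷ []) ∷ []

fourSets : Vec (Subset 5) 5
fourSets =
  (true  ∷ true  ∷ true  ∷ true  ∷ false ∷ []) ∷
  (true  ∷ true  ∷ true  ∷ false ∷ true  ∷ []) ∷
  (true  ∷ true  ∷ false ∷ true  ∷ true  ∷ []) ∷
  (true  ∷ false ∷ true  ∷ true  ∷ true  ∷ []) ∷
  (false ∷ true  ∷ true  ∷ true  ∷ true  ∷ []) ∷ []

fourSets-size : ∀ j → ∣ lookup fourSets j ∣ ≡ 4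
fourSets-size = from-yes (all? λ j → ∣ lookup fourSets j ∣ ≟ 4)

triples-complete : ∀ e → ∣ e ∣ ≡ 3 → ∃ λ i → lookup triples i ≡ e
triples-complete = from-yes (allSubsets? λ e →
  ∣ e ∣ ≟ 3 →-dec any? λ i → ≡-dec Bool._≟_ (lookup triples i) e)

edgeSet : Hypergraph3 5 → Subset 10
edgeSet H = map (edge H) triples

block : Subset 5 → Subset 10
block S = map (λ t → does (t ⊆? S)) triples

-- Only triples can be edges, so the number of edges is the size of edgeSet.
numEdges-edgeSet : ∀ H → numEdges H ≡ ∣ edgeSet H ∣
numEdges-edgeSet H = begin
  length (filterᵇ (edge H) (allSubsets 5))
    ≡⟨ cong length (sym (filterᵇ-absorb is3 (allSubsets 5))) ⟩
  length (filterᵇ (edge H) (filterᵇ (λ e → ∣ e ∣ ≡ᵇ 3) (allSubsets 5)))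
    ≡⟨ length-filterᵇ (edge H) triples ⟩
  ∣ edgeSet H ∣ ∎
  where
  open ≡-Reasoning
  is3 : ∀ e → T (edge H e) → T (∣ e ∣ ≡ᵇ 3)
  is3 e p = ≡⇒≡ᵇ ∣ e ∣ 3 (uniform H e p)

fullBlock⇒clique : ∀ H S → block S ⊆ edgeSet H →
                   ∀ e → ∣ e ∣ ≡ 3 → e ⊆ S → T (edge H e)
fullBlock⇒clique H S block⊆edges e ∣e∣≡3 e⊆S with triples-complete e ∣e∣≡3
... | i , refl = Equivalence.from T-≡ (begin
  edge H (lookup triples i)     ≡⟨ lookup-map i (edge H) triples ⟨
  lookup (edgeSet H) i          ≡⟨ []=⇒lookup (block⊆edges i∈block) ⟩
  true                          ∎)
  where
  open ≡-Reasoning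
  i∈block : i ∈ block S
  i∈block = lookup⇒[]= i (block S)
    (trans (lookup-map i (λ t → does (t ⊆? S)) triples) (dec-true (lookup triples i ⊆? S) e⊆S))

blockFree-bound : ∀ (x : Subset 10) →
                  (∀ j → ¬ block (lookup fourSets j) ⊆ x) → ∣ x ∣ ≤ 7
blockFree-bound = from-yes (allSubsets? λ x →
  all? (λ j → ¬? (block (lookup fourSets j) ⊆? x)) →-dec ∣ x ∣ ≤? 7)

K4-free-bound : ∀ (H : Hypergraph3 5) → ¬ ContainsK 4 H → numEdges H ≤ 7
K4-free-bound H K4-free rewrite numEdges-edgeSet H =
  blockFree-bound (edgeSet H) λ j full →
    K4-free (lookup fourSets j , fourSets-size j ,
             fullBlock⇒clique H (lookup fourSets j) full)

e234 : Subset 5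
e234 = false ∷ true ∷ true ∷ true ∷ false ∷ []

v2345 : Subset 5
v2345 = false ∷ true ∷ true ∷ true ∷ true ∷ []

-- Every 4-set other than {2,3,4,5} contains 1 together with two of 2,3,4,5,
-- hence one of the non-edges {1,2,3}, {1,4,5}.
fourSet-cases : ∀ S → ∣ S ∣ ≡ 4 → S ≡ v2345 ⊎ e123 ⊆ S ⊎ e145 ⊆ S
fourSet-cases = from-yes (allSubsets? λ S →
  ∣ S ∣ ≟ 4 →-dec (≡-dec Bool._≟_ S v2345 ⊎-dec e123 ⊆? S ⊎-dec e145 ⊆? S))

H₃-uniqueK4 : ∀ S → IsK H₃ 4 S → S ≡ v2345
H₃-uniqueK4 S K@(∣S∣≡4 , _) with fourSet-cases S ∣S∣≡4
... | inj₁ S≡v2345      = S≡v2345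
... | inj₂ (inj₁ e123⊆S) = ⊥-elim (nonEdge⇒¬IsK H₃ refl e123⊆S (λ ()) K)
... | inj₂ (inj₂ e145⊆S) = ⊥-elim (nonEdge⇒¬IsK H₃ refl e145⊆S (λ ()) K)

H₃-noTwoK4 : ¬ ContainsTwoK 4 H₃
H₃-noTwoK4 (S₁ , S₂ , S₁≢S₂ , K₁ , K₂) =
  S₁≢S₂ (trans (H₃-uniqueK4 S₁ K₁) (sym (H₃-uniqueK4 S₂ K₂)))

-- The only 5-set is the whole vertex set, which contains both non-edges.
H₃-noKminus : ¬ ContainsKminus 4 H₃
H₃-noKminus (S , D , ∣S∣≡5 , _ , _ , almostClique) =
  twoNonEdges⇒¬Kminus H₃ refl refl (inS e123) (inS e145) (λ ()) (λ ()) (λ ())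
    almostClique
  where
  inS : ∀ e → e ⊆ S
  inS e = subst (e ⊆_) (sym (∣p∣≡n⇒p≡⊤ ∣S∣≡5)) ⊆⊤

H₇ : Hypergraph3 5
H₇ = deleteEdge H₃ e234

fourSet-hits : ∀ S → ∣ S ∣ ≡ 4 → e123 ⊆ S ⊎ e145 ⊆ S ⊎ e234 ⊆ S
fourSet-hits = from-yes (allSubsets? λ S →
  ∣ S ∣ ≟ 4 →-dec (e123 ⊆? S ⊎-dec e145 ⊆? S ⊎-dec e234 ⊆? S))

-- These three triples are exactly the non-edges of H₇, so H₇ is K⁴-free.
H₇-K4-free : ¬ ContainsK 4 H₇
H₇-K4-free (S , K@(∣S∣≡4 , _)) with fourSet-hits S ∣S∣≡4
... | inj₁ e123⊆S        = nonEdge⇒¬IsK H₇ refl e123⊆S (λ ()) K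
... | inj₂ (inj₁ e145⊆S) = nonEdge⇒¬IsK H₇ refl e145⊆S (λ ()) K
... | inj₂ (inj₂ e234⊆S) = nonEdge⇒¬IsK H₇ refl e234⊆S (λ ()) K

turán-5-4 : IsTuranNumber 5 4 7
turán-5-4 = (H₇ , H₇-K4-free , refl) , K4-free-bound

turán-5-4-≤ : ∀ t → IsTuranNumber 5 4 t → t ≤ 7
turán-5-4-≤ t ((H , K4-free , numEdges≡t) , _) =
  subst (_≤ 7) numEdges≡t (K4-free-bound H K4-free)

mainTheorem2 :
    (∀ (t : ℕ) → IsTuranNumber 5 4 t → suc t ≤ numEdges H₃)
    × ¬ ContainsTwoK 4 H₃
    × ¬ ContainsKminus 4 H₃
    × ¬ (∀ (n s t : ℕ) (H : Hypergraph3 n) → IsTuranNumber n s t →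
           numEdges H ≡ suc t → ContainsTwoK s H)
    × ¬ (∀ (n s t : ℕ) (H : Hypergraph3 n) → IsTuranNumber n s t →
           numEdges H ≡ suc t → ContainsKminus s H)
mainTheorem2 =
    (λ t turán → s≤s (turán-5-4-≤ t turán))
  , H₃-noTwoK4
  , H₃-noKminus
  , (λ twoCopies → H₃-noTwoK4 (twoCopies 5 4 7 H₃ turán-5-4 H₃-has-8-edges))
  , (λ kMinus → H₃-noKminus (kMinus 5 4 7 H₃ turán-5-4 H₃-has-8-edges))
  where
  H₃-has-8-edges : numEdges H₃ ≡ 8
  H₃-has-8-edges = refl
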